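{- Let $\mathfrak F$ be a frame satisfying axioms (F1)–(F4). The following are equivalent: (1) $\blacksquare A\subseteq\blacksquare\blacksquare A$ for all $A\in\mathcal G(Z_1)$; (2) $\blacksquare\{y\}'\subseteq\blacksquare\blacksquare\{y\}'$ for all $y\in Z_\partial$; (3) $\boxminus y\le\boxminus\boxminus y$ for all $y\in Z_\partial$; (4) $R_\Box\subseteq Z_\partial\times Z_\partial$ is transitive; (5) $R''_\Box\subseteq Z_1\times Z_1$ is transitive.
   Context: A frame is a tuple $(Z_1,Z_\partial,I,R_\Box,R_\Diamond,T)$ with $Z_1,Z_\partial$ nonempty, $I\subseteq Z_1\times Z_\partial$, $R_\Box\subseteq Z_\partial\times Z_\partial$, $R_\Diamond\subseteq Z_1\times Z_1$, $T\subseteq Z_\partial\times Z_1\times Z_\partial$. Write $x\nmid y$ iff $(x,y)\notin I$. For $U\subseteq Z_1$, $U'=\{y\in Z_\partial:\forall u\in U\ u\nmid y\}$; for $V\subseteq Z_\partial$, $V'=\{x\in Z_1:\forall v\in V\ x\nmid v\}$. $W$ is a Galois set if $W=W''$; stable sets are Galois subsets of $Z_1$, forming $\mathcal G(Z_1)$. On each sort $u\preceq w$ iff $\{u\}'\subseteq\{w\}'$; separated means $\preceq$ is a partial order $\le$; $\Gamma u=\{w:u\le w\}$. For a relation $R$ and tuple $\vec u$, $R\vec u=\{w:wR\vec u\}$, Galois dual $R'$: $wR'\vec u$ iff $w\in(R\vec u)'$; $R$ is smooth if every section of $R'$ is a Galois set. $xR'_\Box v$ iff $\forall y(yR_\Box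 v\Rightarrow x\nmid y)$; $xR''_\Box z$ iff $\forall v(xR'_\Box v\Rightarrow z\nmid v)$. $\blacksquare A=(\{v\in Z_\partial:\exists y\in A'\ vR_\Box y\})'$. Axioms: (F1) separated; (F2) each of $R_\Box,R_\Diamond,T$ is increasing in its first argument and decreasing in each other argument; (F3) for every $v\in Z_\partial,x\in Z_1$, $R_\Box v$, $R_\Diamond x$, $Txv$ are each of the form $\Gamma w$; (F4) $R_\Box,R_\Diamond,T$ are smooth. For $y\in Z_\partial$, $\boxminus y$ denotes the point with $R_\Box y=\Gamma(\boxminus y)$. -}

module Defs where

open import Level using (0ℓ)
open import Data.Product using (Σ; ∃; _×_; _,_; proj₁; proj₂)
open import Relation.Nullary using (¬_)
open import Relation.Unary using (Pred; _⊆_)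
open import Relation.Binary.PropositionalEquality using (_≡_)
open import Relation.Binary using (Transitive)
open import Function.Bundles using (_⇔_)

_≐_ : {A : Set} → Pred A 0ℓ → Pred A 0ℓ → Set
P ≐ Q = (P ⊆ Q) × (Q ⊆ P)

-- The underlying data of a frame (Z₁, Z∂, I, R□, R◇, T).
-- Z₁, Z∂ nonempty: witnessed by points z₁ ∈ Z₁, z∂ ∈ Z∂.
record FrameData : Set₁ where
  field
    Z₁ Z∂ : Set
    z₁ : Z₁
    z∂ : Z∂
    I  : Z₁ → Z∂ → Set
    R□ : Z∂ → Z∂ → Set
    R◇ : Z₁ → Z₁ → Set
    T  : Z∂ → Z₁ → Z∂ → Set

  _∤_ : Z₁ → Z∂ → Set
  x ∤ y = ¬ I x y

  _′₁ : Pred Z₁ 0ℓ → Pred Z∂ 0ℓ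
  (U ′₁) y = ∀ u → U u → u ∤ y

  _′∂ : Pred Z∂ 0ℓ → Pred Z₁ 0ℓ
  (V ′∂) x = ∀ v → V v → x ∤ v

  IsGalois₁ : Pred Z₁ 0ℓ → Set
  IsGalois₁ W = W ≐ ((W ′₁) ′∂)

  IsGalois∂ : Pred Z∂ 0ℓ → Set
  IsGalois∂ W = W ≐ ((W ′∂) ′₁)

  IsStable : Pred Z₁ 0ℓ → Set
  IsStable = IsGalois₁

  ⟨_⟩′₁ : Z₁ → Pred Z∂ 0ℓ
  ⟨ u ⟩′₁ y = u ∤ y

  ⟨_⟩′∂ : Z∂ → Pred Z₁ 0ℓ
  ⟨ v ⟩′∂ x = x ∤ v

  _≤₁_ : Z₁ → Z₁ → Set
  u ≤₁ w = ⟨ u ⟩′₁ ⊆ ⟨ w ⟩′₁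

  _≤∂_ : Z∂ → Z∂ → Set
  u ≤∂ w = ⟨ u ⟩′∂ ⊆ ⟨ w ⟩′∂

  Γ₁ : Z₁ → Pred Z₁ 0ℓ
  Γ₁ u w = u ≤₁ w

  Γ∂ : Z∂ → Pred Z∂ 0ℓ
  Γ∂ u w = u ≤∂ w

  R□′ : Z₁ → Z∂ → Set
  R□′ x v = ((λ y → R□ y v) ′∂) x

  R◇′ : Z∂ → Z₁ → Set
  R◇′ y x = ((λ z → R◇ z x) ′₁) y

  T′ : Z₁ → Z₁ → Z∂ → Set
  T′ w x v = ((λ z → T z x v) ′∂) w

  R□″ : Z₁ → Z₁ → Set
  R□″ x z = ∀ v → R□′ x v → z ∤ v

  ■ : Pred Z₁ 0ℓ → Pred Z₁ 0ℓ
  ■ A = (λ v → Σ Z∂ λ y → (A ′₁) y × R□ v y) ′∂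

record IsFrame (F : FrameData) : Set₁ where
  open FrameData F
  field
    F1₁ : ∀ {u w} → u ≤₁ w → w ≤₁ u → u ≡ w
    F1∂ : ∀ {u w} → u ≤∂ w → w ≤∂ u → u ≡ w
    F2□₁ : ∀ {w w′ v} → R□ w v → w ≤∂ w′ → R□ w′ v
    F2□₂ : ∀ {w v v′} → R□ w v → v′ ≤∂ v → R□ w v′
    F2◇₁ : ∀ {w w′ x} → R◇ w x → w ≤₁ w′ → R◇ w′ x
    F2◇₂ : ∀ {w x x′} → R◇ w x → x′ ≤₁ x → R◇ w x′
    F2T₁ : ∀ {w w′ x v} → T w x v → w ≤∂ w′ → T w′ x v
    F2T₂ : ∀ {w x x′ v} → T w x v → x′ ≤₁ x → T w x′ v
    F2T₃ : ∀ {w x v v′} → T w x v → v′ ≤∂ v → T w x v′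
    F3□ : ∀ v → Σ Z∂ λ w → (λ z → R□ z v) ≐ Γ∂ w
    F3◇ : ∀ x → Σ Z₁ λ w → (λ z → R◇ z x) ≐ Γ₁ w
    F3T : ∀ x v → Σ Z∂ λ w → (λ z → T z x v) ≐ Γ∂ w
    F4□₁ : ∀ v → IsGalois₁ (λ x → R□′ x v)
    F4□₂ : ∀ x → IsGalois∂ (λ v → R□′ x v)
    F4◇₁ : ∀ x → IsGalois∂ (λ y → R◇′ y x)
    F4◇₂ : ∀ y → IsGalois₁ (λ x → R◇′ y x)
    F4T₁ : ∀ x v → IsGalois₁ (λ w → T′ w x v)
    F4T₂ : ∀ w v → IsGalois₁ (λ x → T′ w x v)
    F4T₃ : ∀ w x → IsGalois∂ (λ v → T′ w x v)

  -- ⊟ y : the point with R□ y = Γ (⊟ y)  (unique by F1)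
  ⊟ : Z∂ → Z∂
  ⊟ y = proj₁ (F3□ y)

module Conditions (F : FrameData) (ax : IsFrame F) where
  open FrameData F
  open IsFrame ax

  Cond1 : Set₁
  Cond1 = ∀ (A : Pred Z₁ 0ℓ) → IsStable A → ■ A ⊆ ■ (■ A)

  Cond2 : Set
  Cond2 = ∀ (y : Z∂) → ■ ⟨ y ⟩′∂ ⊆ ■ (■ ⟨ y ⟩′∂)

  Cond3 : Set
  Cond3 = ∀ (y : Z∂) → ⊟ y ≤∂ ⊟ (⊟ y)

  Cond4 : Set
  Cond4 = Transitive R□

  Cond5 : Set
  Cond5 = Transitive R□″

{-# OPTIONS --safe #-}
module Submission where

-- By (F3), R□ is encoded by the map ⊟: z R□ v iff ⊟ v ≤ z, and hence
-- x R□′ v iff x ∤ ⊟ v. Consequently ■{y}′ = {⊟ y}′, so (2) says literally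
-- {⊟ y}′ ⊆ {⊟ ⊟ y}′, which is (3); and (3) is transitivity of R□ read through ⊟.
-- Smoothness (F4) makes the section R□′ x the dual of R□″ x, so on stable
-- sets ■ is the Kripke box of R□″, and transitivity of R□″ yields (1) as for
-- the modal axiom 4.

open import Defs
open import Data.Product using (_×_; _,_; proj₁; proj₂)
open import Function.Base using (_∘_)
open import Function.Bundles using (_⇔_; mk⇔)
open import Level using (0ℓ)
open import Relation.Unary using (Pred; _⊆_)

module FrameProperties (F : FrameData) (ax : IsFrame F) where
  open FrameData F
  open IsFrame ax
  open Conditions F ax

  ⊟-minimal : ∀ {v z} → R□ z v → ⊟ v ≤∂ z
  ⊟-minimal {v} = proj₁ (proj₂ (F3□ v))

  ⊟≤⇒R□ : ∀ {v z} → ⊟ v ≤∂ z → R□ z v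
  ⊟≤⇒R□ {v} = proj₂ (proj₂ (F3□ v))

  R□-⊟ : ∀ {v} → R□ (⊟ v) v
  R□-⊟ = ⊟≤⇒R□ (λ x∤⊟v → x∤⊟v)

  ⊟-mono : ∀ {y z} → y ≤∂ z → ⊟ y ≤∂ ⊟ z
  ⊟-mono y≤z = ⊟-minimal (F2□₂ R□-⊟ y≤z)

  ∤⊟⇒R□′ : ∀ {x v} → x ∤ ⊟ v → R□′ x v
  ∤⊟⇒R□′ x∤⊟v _ zR□v = ⊟-minimal zR□v x∤⊟v

  R□′⇒∤⊟ : ∀ {x v} → R□′ x v → x ∤ ⊟ v
  R□′⇒∤⊟ xR□′v = xR□′v _ R□-⊟

  R□′-closed : ∀ {x v} → (∀ z → R□″ x z → z ∤ v) → R□′ x v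
  R□′-closed {x} = proj₂ (F4□₂ x)

  ⟨⟩′∂-stable : ∀ y → IsStable ⟨ y ⟩′∂
  ⟨⟩′∂-stable y = (λ x∤y z y≤z → y≤z _ x∤y) , (λ x∈⟨y⟩″ → x∈⟨y⟩″ y (λ _ u∤y → u∤y))

  ■-mono : ∀ {A B : Pred Z₁ 0ℓ} → A ⊆ B → ■ A ⊆ ■ B
  ■-mono A⊆B x∈■A v (y , y∈B′ , vR□y) = x∈■A v (y , (λ u u∈A → y∈B′ u (A⊆B u∈A)) , vR□y)

  ■⟨⟩′∂ : ∀ y → ■ ⟨ y ⟩′∂ ≐ ⟨ ⊟ y ⟩′∂
  ■⟨⟩′∂ y = (λ x∈■ → x∈■ (⊟ y) (y , (λ _ u∤y → u∤y) , R□-⊟))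
          , (λ x∤⊟y v (z , y≤z , vR□z) → ⊟-minimal vR□z (⊟-mono (λ {u} → y≤z u) x∤⊟y))

  ■-intro : ∀ {A x} → (∀ {z} → R□″ x z → A z) → ■ A x
  ■-intro R□″x⊆A v (y , y∈A′ , vR□y) = R□′-closed (λ z xR□″z → y∈A′ z (R□″x⊆A xR□″z)) v vR□y

  ■-elim : ∀ {A x z} → IsStable A → ■ A x → R□″ x z → A z
  ■-elim (_ , A″⊆A) x∈■A xR□″z = A″⊆A (λ y y∈A′ → xR□″z y (λ v vR□y → x∈■A v (y , y∈A′ , vR□y)))

  cond1⇒cond2 : Cond1 → Cond2
  cond1⇒cond2 cond1 y = cond1 ⟨ y ⟩′∂ (⟨⟩′∂-stable y)

  cond2⇒cond3 : Cond2 → Cond3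
  cond2⇒cond3 cond2 y x∤⊟y =
    proj₁ (■⟨⟩′∂ (⊟ y)) (■-mono (proj₁ (■⟨⟩′∂ y)) (cond2 y (proj₂ (■⟨⟩′∂ y) x∤⊟y)))

  cond3⇒cond4 : Cond3 → Cond4
  cond3⇒cond4 cond3 {k = v} zR□y yR□v =
    ⊟≤⇒R□ (⊟-minimal zR□y ∘ ⊟-mono (⊟-minimal yR□v) ∘ cond3 v)

  cond4⇒cond3 : Cond4 → Cond3
  cond4⇒cond3 cond4 y = ⊟-minimal (cond4 R□-⊟ R□-⊟)

  cond3⇒cond5 : Cond3 → Cond5
  cond3⇒cond5 cond3 xR□″y yR□″z v xR□′v =
    yR□″z v (∤⊟⇒R□′ (xR□″y (⊟ v) (∤⊟⇒R□′ (cond3 v (R□′⇒∤⊟ xR□′v)))))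

  cond5⇒cond1 : Cond5 → Cond1
  cond5⇒cond1 cond5 A A-stable x∈■A =
    ■-intro (λ xR□″u → ■-intro (λ uR□″z → ■-elim A-stable x∈■A (cond5 xR□″u uR□″z)))

proposition5p5 : (F : FrameData) (ax : IsFrame F) →
    let open Conditions F ax in
    (Cond1 ⇔ Cond2) × (Cond2 ⇔ Cond3) × (Cond3 ⇔ Cond4) × (Cond4 ⇔ Cond5)
proposition5p5 F ax =
    mk⇔ cond1⇒cond2 (cond5⇒cond1 ∘ cond3⇒cond5 ∘ cond2⇒cond3)
  , mk⇔ cond2⇒cond3 (cond1⇒cond2 ∘ cond5⇒cond1 ∘ cond3⇒cond5)
  , mk⇔ cond3⇒cond4 cond4⇒cond3
  , mk⇔ (cond3⇒cond5 ∘ cond4⇒cond3) (cond3⇒cond4 ∘ cond2⇒cond3 ∘ cond1⇒cond2 ∘ cond5⇒cond1)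
  where open FrameProperties F ax
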